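{- Let $n$ be an even integer and let $G$ be a triangle-free graph on $n$ vertices with independence number $\alpha(G)\geq n/2$. Then $D_2^b(G)\leq \frac{n^2}{16}$. Additionally, if $D_2^b(G)=\frac{n^2}{16}$, then $G\cong K_{\frac{3n}{4},\frac{n}{4}}$.
   Context: For $A\subseteq V(G)$, $e(A)$ denotes the number of edges of $G$ with both endpoints in $A$. $D_2^b(G)=\min (e(A)+e(B))$, where the minimum is over all partitions $V(G)=A\cup B$ with $|A|=|B|=n/2$. $K_{a,b}$ is the complete bipartite graph with class sizes $a,b$. -}

module Defs where

open import Data.Nat using (ℕ; zero; suc; _+_; _*_; _<_; _≤_; _<ᵇ_)
open import Data.Bool using (Bool; true; false; T; _xor_; _∧_)
open import Data.Fin using (Fin; toℕ)
open import Data.Fin.Subset using (Subset; _∈_; _∉_; ∁; ∣_∣)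
open import Data.Nat.ListAction using (sum)
open import Data.List using (List; map; allFin; filterᵇ; length)
open import Data.Product using (Σ; _×_; ∃; ∃-syntax)
open import Relation.Binary.PropositionalEquality using (_≡_)
open import Relation.Nullary using (¬_)
open import Function.Bundles using (_↔_)
open import Function.Bundles using (Inverse)
import Data.Vec

record Graph (n : ℕ) : Set where
  field
    adj   : Fin n → Fin n → Bool
    sym   : ∀ i j → adj i j ≡ adj j i
    irrefl : ∀ i → adj i i ≡ false
open Graph public

Adj : ∀ {n} → Graph n → Fin n → Fin n → Set
Adj G i j = T (adj G i j)

TriangleFree : ∀ {n} → Graph n → Set
TriangleFree G = ∀ i j k → ¬ (Adj G i j × Adj G j k × Adj G i k)

Independent : ∀ {n} → Graph n → Subset n → Set
Independent G S = ∀ i j → i ∈ S → j ∈ S → ¬ Adj G i j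

IndepAtLeast : ∀ {n} → Graph n → ℕ → Set
IndepAtLeast G k = ∃[ S ] (Independent G S × k ≤ ∣ S ∣)

memᵇ : ∀ {n} → Fin n → Subset n → Bool
memᵇ i A = Data.Vec.lookup A i

e : ∀ {n} → Graph n → Subset n → ℕ
e {n} G A = sum (map (λ i → length (filterᵇ (λ j →
              (toℕ i <ᵇ toℕ j) ∧ (memᵇ i A ∧ (memᵇ j A ∧ adj G i j))) (allFin n)))
            (allFin n))

cost : ∀ {n} → Graph n → Subset n → ℕ
cost G A = e G A + e G (∁ A)

-- d = D₂ᵇ(G) for a graph on 2m vertices: d is the minimum of e(A)+e(B)
-- over partitions V = A ∪ B with |A| = |B| = m (B the complement of A).
IsD2b : ∀ {m} → Graph (m + m) → ℕ → Set
IsD2b {m} G d =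
  (∃[ A ] (∣ A ∣ ≡ m × cost G A ≡ d)) ×
  (∀ A → ∣ A ∣ ≡ m → d ≤ cost G A)

-- complete bipartite graph K_{a,b} on vertex set Fin (a + b):
-- the first a vertices form one class, the last b the other.
K : (a b : ℕ) → Graph (a + b)
K a b = record
  { adj = λ i j → (toℕ i <ᵇ a) xor (toℕ j <ᵇ a)
  ; sym = λ i j → xor-comm (toℕ i <ᵇ a) (toℕ j <ᵇ a)
  ; irrefl = λ i → xor-same (toℕ i <ᵇ a)
  }
  where
  xor-comm : ∀ x y → (x xor y) ≡ (y xor x)
  xor-comm false false = Relation.Binary.PropositionalEquality.refl
  xor-comm false true = Relation.Binary.PropositionalEquality.refl
  xor-comm true false = Relation.Binary.PropositionalEquality.refl
  xor-comm true true = Relation.Binary.PropositionalEquality.refl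
  xor-same : ∀ x → (x xor x) ≡ false
  xor-same false = Relation.Binary.PropositionalEquality.refl
  xor-same true = Relation.Binary.PropositionalEquality.refl

_≅_ : ∀ {n k} → Graph n → Graph k → Set
_≅_ {n} {k} G H = Σ (Fin n ↔ Fin k) λ σ →
  ∀ i j → adj G i j ≡ adj H (Inverse.to σ i) (Inverse.to σ j)

module Submission where

-- Shrink an independent set to a set S of size m = n/2.  The balanced cut (S, R) costs e(R), and
-- splitting R along the neighbourhood N of a vertex of maximum degree into R gives Mantel's bound
-- e(R) ≤ |M| |N| with M = R ∖ N, hence 16 D₂ᵇ(G) ≤ 16 |M| |N| ≤ (2 (|M| + |N|))² = n².
-- In the equality case |M| = |N| = k, m = 2k, M and N are independent and completely joined, so
-- by triangle-freeness no vertex sees both M and N.  For p ⊆ S with |p| = k, the two balanced cuts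
-- (M ∪ p, N ∪ S ∖ p) and (N ∪ p, M ∪ S ∖ p) together cost Σ_{i ∈ S} (deg_M i + deg_N i) ≤ 2k², so
-- minimality makes each cost exactly k² and every vertex of S see all of M or all of N.  Taking p
-- among the vertices of S that avoid N (or, symmetrically, M) forces all of S to avoid N and see
-- all of M: G is complete bipartite with classes M and S ∪ N, that is K_{3k,k}.

open import Data.Bool using (Bool; true; false; not; _∧_; _∨_; _xor_)
open import Data.Bool.Properties using (∧-conicalˡ; ∧-conicalʳ; T-≡; ¬-not)
open import Data.Empty using (⊥; ⊥-elim)
open import Data.Fin using (Fin; zero; suc; toℕ; join; splitAt)
open import Data.Fin.Properties using (toℕ-injective; toℕ-↑ˡ; toℕ-↑ʳ; toℕ<n; splitAt-join; join-splitAt)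
open import Data.Fin.Subset using (Subset; ∣_∣; ∁)
import Data.List as List using ([]; _∷_; map; tabulate; allFin; filterᵇ; length)
import Data.List.Properties as List using (map-tabulate)
import Data.Nat.ListAction as List using (sum)
open import Data.List.Membership.Propositional.Properties using (∈-allFin)
import Data.List.Relation.Unary.All as All
open import Data.Nat using (ℕ; zero; suc; _+_; _*_; _≤_; _<_; _<ᵇ_; _≡ᵇ_; z≤n; s≤s; s≤s⁻¹; ∣_-_∣)
open import Data.Nat.Properties
open import Data.Nat.Tactic.RingSolver using (solve-∀)
open import Data.List.Extrema ≤-totalOrder using (argmax; f[xs]≤f[argmax])
open import Data.Product using (Σ; _×_; _,_; proj₁; proj₂; ∃; ∃-syntax)
open import Data.Sum using (_⊎_; inj₁; inj₂; reduce)
import Data.Sum as Sum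
import Data.Vec as Vec
import Data.Vec.Properties as Vecₚ
open import Function using (_∘_)
open import Function.Bundles using (Equivalence; Inverse; _↔_; mk↔ₛ′)
open import Relation.Binary.PropositionalEquality
open import Relation.Nullary using (yes; no)
open import Algebra.Properties.CommutativeSemigroup *-commutativeSemigroup using (x∙yz≈y∙xz)
open import Algebra.Properties.Semiring.Sum +-*-semiring
  using (sum; sum-cong-≗; ∑-distrib-+; ∑-comm; *-distribˡ-sum; *-distribʳ-sum; sum-replicate-zero)

open import Defs hiding (sym)

bit : Bool → ℕ
bit true = 1
bit false = 0

bit≤1 : ∀ b → bit b ≤ 1
bit≤1 true = ≤-refl
bit≤1 false = z≤n

bit-∧ : ∀ x y → bit (x ∧ y) ≡ bit x * bit y
bit-∧ true y = sym (+-identityʳ (bit y))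
bit-∧ false y = refl

bit-∧-not+bit-∧ : ∀ x y → bit (x ∧ not y) + bit (x ∧ y) ≡ bit x
bit-∧-not+bit-∧ true true = refl
bit-∧-not+bit-∧ true false = refl
bit-∧-not+bit-∧ false y = refl

bit-⊆-split : ∀ s p → (p ≡ true → s ≡ true) → bit s ≡ bit p + bit (s ∧ not p)
bit-⊆-split true true _ = refl
bit-⊆-split true false _ = refl
bit-⊆-split false false _ = refl
bit-⊆-split false true p⊆s with p⊆s refl
... | ()

bit-one-of-three : ∀ s x y → bit s + (bit x + bit y) ≡ 1 → not x ≡ true → s ≡ true ⊎ y ≡ true
bit-one-of-three true x y _ _ = inj₁ refl
bit-one-of-three false x true _ _ = inj₂ refl
bit-one-of-three false true false _ ()
bit-one-of-three false false false () _

bit-∧-cover : ∀ s x y → (s ≡ true → x ≡ true ⊎ y ≡ true) → bit s ≤ bit (s ∧ x) + bit (s ∧ y)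
bit-∧-cover false x y _ = z≤n
bit-∧-cover true true y _ = s≤s z≤n
bit-∧-cover true false true _ = s≤s z≤n
bit-∧-cover true false false x∨y with x∨y refl
... | inj₁ ()
... | inj₂ ()

bit-∨-split : ∀ s x y p → bit s + (bit x + bit y) ≡ 1 → (p ≡ true → s ≡ true) →
  bit (x ∨ p) ≡ bit x + bit p × bit (not (x ∨ p)) ≡ bit y + bit (s ∧ not p)
bit-∨-split true false false p _ _ = refl , refl
bit-∨-split false true false false _ _ = refl , refl
bit-∨-split false false true false _ _ = refl , refl
bit-∨-split false x y true _ p⊆s with p⊆s refl
... | ()
bit-∨-split true true y p () _
bit-∨-split true false true p () _
bit-∨-split false true true p () _
bit-∨-split false false false p () _

bit+bit-not : ∀ b → bit b + bit (not b) ≡ 1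
bit+bit-not true = refl
bit+bit-not false = refl

bit≡0⇒≡false : ∀ {b} → bit b ≡ 0 → b ≡ false
bit≡0⇒≡false {false} _ = refl

bit≡1⇒≡true : ∀ {b} → bit b ≡ 1 → b ≡ true
bit≡1⇒≡true {true} _ = refl

bit-true-* : ∀ {b} x → b ≡ true → bit b * x ≡ x
bit-true-* x refl = +-identityʳ x

<ᵇ-trichotomy : ∀ m n → m ≢ n → bit (m <ᵇ n) + bit (n <ᵇ m) ≡ 1
<ᵇ-trichotomy zero zero m≢n = ⊥-elim (m≢n refl)
<ᵇ-trichotomy zero (suc n) _ = refl
<ᵇ-trichotomy (suc m) zero _ = refl
<ᵇ-trichotomy (suc m) (suc n) m≢n = <ᵇ-trichotomy m n (m≢n ∘ cong suc)

≡ᵇ0⇒≡0 : ∀ {d} → (d ≡ᵇ 0) ≡ true → d ≡ 0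
≡ᵇ0⇒≡0 {zero} _ = refl

x+y≤p∧2p≤x+2y⇒ : ∀ x y p → x + y ≤ p → 2 * p ≤ x + 2 * y → x ≡ 0 × y ≡ p
x+y≤p∧2p≤x+2y⇒ x y p x+y≤p 2p≤x+2y = x≡0 , y≡p
  where
  open ≤-Reasoning
  p≤y : p ≤ y
  p≤y = +-cancelˡ-≤ p p y (begin
    p + p        ≡⟨ cong (p +_) (+-identityʳ p) ⟨
    2 * p        ≤⟨ 2p≤x+2y ⟩
    x + 2 * y    ≡⟨ cong (λ t → x + (y + t)) (+-identityʳ y) ⟩
    x + (y + y)  ≡⟨ +-assoc x y y ⟨
    (x + y) + y  ≤⟨ +-monoˡ-≤ y x+y≤p ⟩
    p + y        ∎)
  y≡p : y ≡ p
  y≡p = ≤-antisym (≤-trans (m≤n+m y x) x+y≤p) p≤y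
  x≡0 : x ≡ 0
  x≡0 = n≤0⇒n≡0 (+-cancelʳ-≤ y x 0 (≤-trans x+y≤p (≤-reflexive (sym y≡p))))

≤∧≤∧+≤⇒≡ : ∀ {c a b} → c ≤ a → c ≤ b → a + b ≤ c + c → a ≡ c × b ≡ c
≤∧≤∧+≤⇒≡ {c} {a} {b} c≤a c≤b a+b≤c+c =
  ≤-antisym (+-cancelʳ-≤ c a c (≤-trans (+-monoʳ-≤ a c≤b) a+b≤c+c)) c≤a ,
  ≤-antisym (+-cancelˡ-≤ c b c (≤-trans (+-monoˡ-≤ b c≤a) a+b≤c+c)) c≤b

k+k≤a+b⇒k≤a⊎k≤b : ∀ a b k → k + k ≤ a + b → k ≤ a ⊎ k ≤ b
k+k≤a+b⇒k≤a⊎k≤b a b k k+k≤a+b with ≤-total k a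
... | inj₁ k≤a = inj₁ k≤a
... | inj₂ a≤k = inj₂ (+-cancelˡ-≤ k k b (≤-trans k+k≤a+b (+-monoˡ-≤ b a≤k)))

[a+b]²≡4ab+∣a-b∣²-≤ : ∀ {a b} → a ≤ b → (a + b) * (a + b) ≡ 4 * (a * b) + ∣ a - b ∣ * ∣ a - b ∣
[a+b]²≡4ab+∣a-b∣²-≤ {a} a≤b with m≤n⇒∃[o]m+o≡n a≤b
... | c , refl rewrite ∣m-m+n∣≡n a c = identity a c
  where
  identity : ∀ a c → (a + (a + c)) * (a + (a + c)) ≡ 4 * (a * (a + c)) + c * c
  identity = solve-∀

[a+b]²≡4ab+∣a-b∣² : ∀ a b → (a + b) * (a + b) ≡ 4 * (a * b) + ∣ a - b ∣ * ∣ a - b ∣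
[a+b]²≡4ab+∣a-b∣² a b with ≤-total a b
... | inj₁ a≤b = [a+b]²≡4ab+∣a-b∣²-≤ a≤b
... | inj₂ b≤a = begin
  (a + b) * (a + b)                       ≡⟨ cong (λ t → t * t) (+-comm a b) ⟩
  (b + a) * (b + a)                       ≡⟨ [a+b]²≡4ab+∣a-b∣²-≤ b≤a ⟩
  4 * (b * a) + ∣ b - a ∣ * ∣ b - a ∣
    ≡⟨ cong₂ (λ u v → 4 * u + v * v) (*-comm b a) (∣-∣-comm b a) ⟩
  4 * (a * b) + ∣ a - b ∣ * ∣ a - b ∣     ∎
  where open ≡-Reasoning

[2[a+b]]²≡16ab+4∣a-b∣² : ∀ a b →
  (a + b + (a + b)) * (a + b + (a + b)) ≡ 16 * (a * b) + 4 * (∣ a - b ∣ * ∣ a - b ∣)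
[2[a+b]]²≡16ab+4∣a-b∣² a b = begin
  (a + b + (a + b)) * (a + b + (a + b))            ≡⟨ double² (a + b) ⟩
  4 * ((a + b) * (a + b))                          ≡⟨ cong (4 *_) ([a+b]²≡4ab+∣a-b∣² a b) ⟩
  4 * (4 * (a * b) + ∣ a - b ∣ * ∣ a - b ∣)        ≡⟨ distribute (a * b) (∣ a - b ∣ * ∣ a - b ∣) ⟩
  16 * (a * b) + 4 * (∣ a - b ∣ * ∣ a - b ∣)       ∎
  where
  open ≡-Reasoning
  double² : ∀ s → (s + s) * (s + s) ≡ 4 * (s * s)
  double² = solve-∀
  distribute : ∀ x y → 4 * (4 * x + y) ≡ 16 * x + 4 * y
  distribute = solve-∀

16d≤[2[a+b]]² : ∀ {d} a b → d ≤ a * b → 16 * d ≤ (a + b + (a + b)) * (a + b + (a + b))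
16d≤[2[a+b]]² {d} a b d≤ab = begin
  16 * d                                       ≤⟨ *-monoʳ-≤ 16 d≤ab ⟩
  16 * (a * b)                                 ≤⟨ m≤m+n (16 * (a * b)) _ ⟩
  16 * (a * b) + 4 * (∣ a - b ∣ * ∣ a - b ∣)    ≡⟨ [2[a+b]]²≡16ab+4∣a-b∣² a b ⟨
  (a + b + (a + b)) * (a + b + (a + b))        ∎
  where open ≤-Reasoning

16d≡[2[a+b]]²⇒ : ∀ {d} a b → d ≤ a * b → 16 * d ≡ (a + b + (a + b)) * (a + b + (a + b)) →
  d ≡ a * b × a ≡ b
16d≡[2[a+b]]²⇒ {d} a b d≤ab tight = d≡ab , ∣m-n∣≡0⇒m≡n δ≡0
  where
  δ = ∣ a - b ∣
  16d≡16ab+4δ² : 16 * d ≡ 16 * (a * b) + 4 * (δ * δ)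
  16d≡16ab+4δ² = trans tight ([2[a+b]]²≡16ab+4∣a-b∣² a b)
  d≡ab : d ≡ a * b
  d≡ab = ≤-antisym d≤ab (*-cancelˡ-≤ 16
    (≤-trans (m≤m+n (16 * (a * b)) (4 * (δ * δ))) (≤-reflexive (sym 16d≡16ab+4δ²))))
  4δ²≤0 : 16 * (a * b) + 4 * (δ * δ) ≤ 16 * (a * b) + 0
  4δ²≤0 = begin
    16 * (a * b) + 4 * (δ * δ)  ≡⟨ 16d≡16ab+4δ² ⟨
    16 * d                      ≤⟨ *-monoʳ-≤ 16 d≤ab ⟩
    16 * (a * b)                ≡⟨ +-identityʳ (16 * (a * b)) ⟨
    16 * (a * b) + 0            ∎
    where open ≤-Reasoning
  δ≡0 : δ ≡ 0
  δ≡0 = reduce (m*n≡0⇒m≡0∨n≡0 δ (*-cancelˡ-≡ (δ * δ) 0 4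
    (n≤0⇒n≡0 (+-cancelˡ-≤ (16 * (a * b)) (4 * (δ * δ)) 0 4δ²≤0))))

sum-mono-≤ : ∀ {n} {f g : Fin n → ℕ} → (∀ i → f i ≤ g i) → sum f ≤ sum g
sum-mono-≤ {zero} f≤g = z≤n
sum-mono-≤ {suc n} f≤g = +-mono-≤ (f≤g zero) (sum-mono-≤ (f≤g ∘ suc))

sum-mono-≤-rigid : ∀ {n} {f g : Fin n → ℕ} → (∀ i → f i ≤ g i) → sum g ≤ sum f →
  ∀ i → f i ≡ g i
sum-mono-≤-rigid {suc n} {f} {g} f≤g g≤f zero = ≤-antisym (f≤g zero)
  (+-cancelʳ-≤ _ _ _ (≤-trans g≤f (+-monoʳ-≤ (f zero) (sum-mono-≤ (f≤g ∘ suc)))))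
sum-mono-≤-rigid {suc n} {f} {g} f≤g g≤f (suc i) = sum-mono-≤-rigid (f≤g ∘ suc)
  (+-cancelˡ-≤ (g zero) _ _ (≤-trans g≤f (+-monoˡ-≤ _ (f≤g zero)))) i

sum≡0⇒≡0 : ∀ {n} (f : Fin n → ℕ) → sum f ≡ 0 → ∀ i → f i ≡ 0
sum≡0⇒≡0 {n} f sum≡0 i = sym (sum-mono-≤-rigid {f = λ _ → 0} (λ _ → z≤n)
  (≤-trans (≤-reflexive sum≡0) (≤-reflexive (sym (sum-replicate-zero n)))) i)

sum-ones : ∀ n → sum {n} (λ _ → 1) ≡ n
sum-ones zero = refl
sum-ones (suc n) = cong suc (sum-ones n)

listSum-tabulate : ∀ {n} (f : Fin n → ℕ) → List.sum (List.tabulate f) ≡ sum f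
listSum-tabulate {zero} f = refl
listSum-tabulate {suc n} f = cong (f zero +_) (listSum-tabulate (f ∘ suc))

listSum-allFin : ∀ {n} (f : Fin n → ℕ) → List.sum (List.map f (List.allFin n)) ≡ sum f
listSum-allFin f = trans (cong List.sum (List.map-tabulate (λ i → i) f)) (listSum-tabulate f)

length-filterᵇ : ∀ {A : Set} (p : A → Bool) xs →
  List.length (List.filterᵇ p xs) ≡ List.sum (List.map (bit ∘ p) xs)
length-filterᵇ p List.[] = refl
length-filterᵇ p (x List.∷ xs) with p x
... | true = cong suc (length-filterᵇ p xs)
... | false = length-filterᵇ p xs

sum-upperTriangle : ∀ {n} (P : Fin n → Fin n → ℕ) →
  (∀ i j → P i j ≡ P j i) → (∀ i → P i i ≡ 0) →
  2 * sum (λ i → sum (λ j → bit (toℕ i <ᵇ toℕ j) * P i j)) ≡ sum (λ i → sum (λ j → P i j))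
sum-upperTriangle {n} P P-sym P-diag = begin
  2 * U                                                    ≡⟨ cong (U +_) (+-identityʳ U) ⟩
  U + U                                                    ≡⟨ cong (U +_) (∑-comm {n} {n} _) ⟩
  U + sum (λ i → sum (λ j → lt j i * P j i))
    ≡⟨ cong (U +_) (sum-cong-≗ λ i → sum-cong-≗ λ j → cong (lt j i *_) (P-sym j i)) ⟩
  U + sum (λ i → sum (λ j → lt j i * P i j))               ≡⟨ ∑-distrib-+ {n} _ _ ⟨
  sum (λ i → sum (λ j → lt i j * P i j) + sum (λ j → lt j i * P i j))
    ≡⟨ sum-cong-≗ (λ i → ∑-distrib-+ {n} (λ j → lt i j * P i j) (λ j → lt j i * P i j)) ⟨
  sum (λ i → sum (λ j → lt i j * P i j + lt j i * P i j))
    ≡⟨ sum-cong-≗ (λ i → sum-cong-≗ (onePair i)) ⟩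
  sum (λ i → sum (λ j → P i j))                            ∎
  where
  open ≡-Reasoning
  lt : Fin n → Fin n → ℕ
  lt i j = bit (toℕ i <ᵇ toℕ j)
  U = sum (λ i → sum (λ j → lt i j * P i j))
  onePair : ∀ i j → lt i j * P i j + lt j i * P i j ≡ P i j
  onePair i j with i Data.Fin.≟ j
  ... | yes refl rewrite P-diag i = cong₂ _+_ (*-zeroʳ (lt i i)) (*-zeroʳ (lt i i))
  ... | no i≢j = begin
    lt i j * P i j + lt j i * P i j  ≡⟨ *-distribʳ-+ (P i j) (lt i j) (lt j i) ⟨
    (lt i j + lt j i) * P i j
      ≡⟨ cong (_* P i j) (<ᵇ-trichotomy (toℕ i) (toℕ j) (i≢j ∘ toℕ-injective)) ⟩
    1 * P i j                        ≡⟨ *-identityˡ (P i j) ⟩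
    P i j                            ∎

argmax-Fin : ∀ {n} → Fin n → (f : Fin n → ℕ) → ∃ λ v → ∀ u → f u ≤ f v
argmax-Fin {n} v₀ f = argmax f v₀ (List.allFin n) ,
  λ u → All.lookup (f[xs]≤f[argmax] {f = f} v₀ (List.allFin n)) (∈-allFin u)

-- Vertex sets as Boolean predicates

χ : ∀ {n} → (Fin n → Bool) → Fin n → ℕ
χ X = bit ∘ X

size : ∀ {n} → (Fin n → Bool) → ℕ
size X = sum (χ X)

sumOver : ∀ {n} → (Fin n → Bool) → (Fin n → ℕ) → ℕ
sumOver X f = sum (λ i → χ X i * f i)

_─_ : ∀ {n} → (Fin n → Bool) → (Fin n → Bool) → Fin n → Bool
(X ─ Y) i = X i ∧ not (Y i)

_∩_ : ∀ {n} → (Fin n → Bool) → (Fin n → Bool) → Fin n → Bool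
(X ∩ Y) i = X i ∧ Y i

_⊆_ : ∀ {n} → (Fin n → Bool) → (Fin n → Bool) → Set
X ⊆ Y = ∀ i → X i ≡ true → Y i ≡ true

sumOver-distrib-+ : ∀ {n} (X : Fin n → Bool) (f g : Fin n → ℕ) →
  sumOver X (λ i → f i + g i) ≡ sumOver X f + sumOver X g
sumOver-distrib-+ {n} X f g =
  trans (sum-cong-≗ (λ i → *-distribˡ-+ (χ X i) (f i) (g i))) (∑-distrib-+ {n} _ _)

sumOver-split : ∀ {n} (X Y Z : Fin n → Bool) (f : Fin n → ℕ) → (∀ i → χ X i ≡ χ Y i + χ Z i) →
  sumOver X f ≡ sumOver Y f + sumOver Z f
sumOver-split {n} X Y Z f X≡Y+Z =
  trans (sum-cong-≗ (λ i → trans (cong (_* f i) (X≡Y+Z i)) (*-distribʳ-+ (f i) (χ Y i) (χ Z i))))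
        (∑-distrib-+ {n} _ _)

sumOver-const : ∀ {n} (X : Fin n → Bool) c → sumOver X (λ _ → c) ≡ size X * c
sumOver-const X c = sym (*-distribʳ-sum c (χ X))

sumOver-mono-≤ : ∀ {n} (X : Fin n → Bool) {f : Fin n → ℕ} {c} → (∀ i → f i ≤ c) →
  sumOver X f ≤ size X * c
sumOver-mono-≤ X {c = c} f≤c = ≤-trans (sum-mono-≤ (λ i → *-monoʳ-≤ (χ X i) (f≤c i)))
  (≤-reflexive (sumOver-const X c))

sumOver-cong : ∀ {n} (X : Fin n → Bool) {f g : Fin n → ℕ} → (∀ i → X i ≡ true → f i ≡ g i) →
  sumOver X f ≡ sumOver X g
sumOver-cong X {f} {g} f≡g = sum-cong-≗ pointwise
  where
  pointwise : ∀ i → χ X i * f i ≡ χ X i * g i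
  pointwise i with X i in Xi
  ... | true = cong (1 *_) (f≡g i Xi)
  ... | false = refl

sumOver≡0⇐ : ∀ {n} (X : Fin n → Bool) {f : Fin n → ℕ} → (∀ i → X i ≡ true → f i ≡ 0) →
  sumOver X f ≡ 0
sumOver≡0⇐ X f≡0 = trans (sumOver-cong X f≡0) (trans (sumOver-const X 0) (*-zeroʳ (size X)))

sumOver≡0⇒ : ∀ {n} (X : Fin n → Bool) {f : Fin n → ℕ} → sumOver X f ≡ 0 →
  ∀ i → X i ≡ true → f i ≡ 0
sumOver≡0⇒ X {f} sum≡0 i Xi = trans (sym (bit-true-* (f i) Xi)) (sum≡0⇒≡0 _ sum≡0 i)

sumOver-rigid : ∀ {n} (X : Fin n → Bool) {f : Fin n → ℕ} {c} → (∀ i → f i ≤ c) →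
  size X * c ≤ sumOver X f → ∀ i → X i ≡ true → f i ≡ c
sumOver-rigid X {f} {c} f≤c full i Xi = begin
  f i           ≡⟨ bit-true-* (f i) Xi ⟨
  χ X i * f i   ≡⟨ sum-mono-≤-rigid (λ j → *-monoʳ-≤ (χ X j) (f≤c j))
                     (≤-trans (≤-reflexive (sumOver-const X c)) full) i ⟩
  χ X i * c     ≡⟨ bit-true-* c Xi ⟩
  c             ∎
  where open ≡-Reasoning

size-─+size-∩ : ∀ {n} (X Y : Fin n → Bool) → size (X ─ Y) + size (X ∩ Y) ≡ size X
size-─+size-∩ {n} X Y =
  trans (sym (∑-distrib-+ {n} (χ (X ─ Y)) (χ (X ∩ Y)))) (sum-cong-≗ (λ i → bit-∧-not+bit-∧ (X i) (Y i)))

size+size-not : ∀ {n} (X : Fin n → Bool) → size X + size (not ∘ X) ≡ n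
size+size-not {n} X = begin
  size X + size (not ∘ X)        ≡⟨ ∑-distrib-+ (χ X) (χ (not ∘ X)) ⟨
  sum (λ i → bit (X i) + bit (not (X i)))  ≡⟨ sum-cong-≗ (bit+bit-not ∘ X) ⟩
  sum {n} (λ _ → 1)              ≡⟨ sum-ones n ⟩
  n                              ∎
  where open ≡-Reasoning

subset-of-size : ∀ {n} (X : Fin n → Bool) k → k ≤ size X → ∃ λ Y → Y ⊆ X × size Y ≡ k
subset-of-size {zero} X zero _ = (λ ()) , (λ ()) , refl
subset-of-size {suc n} X zero _ = (λ _ → false) , (λ _ ()) , sum-replicate-zero (suc n)
subset-of-size {suc n} X (suc k) k<∣X∣ with X zero in X₀
... | true = let Y , Y⊆X , ∣Y∣ = subset-of-size (X ∘ suc) k (s≤s⁻¹ k<∣X∣) in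
  (λ { zero → true ; (suc i) → Y i }) , (λ { zero _ → X₀ ; (suc i) → Y⊆X i }) , cong suc ∣Y∣
... | false = let Y , Y⊆X , ∣Y∣ = subset-of-size (X ∘ suc) (suc k) k<∣X∣ in
  (λ { zero → false ; (suc i) → Y i }) , (λ { zero () ; (suc i) → Y⊆X i }) , ∣Y∣

∣A∣≡size : ∀ {n} (A : Subset n) → ∣ A ∣ ≡ size (Vec.lookup A)
∣A∣≡size Vec.[] = refl
∣A∣≡size (true Vec.∷ A) = cong suc (∣A∣≡size A)
∣A∣≡size (false Vec.∷ A) = ∣A∣≡size A

χ-lookup-tabulate : ∀ {n} (X : Fin n → Bool) i → χ (Vec.lookup (Vec.tabulate X)) i ≡ χ X i
χ-lookup-tabulate X i = cong bit (Vecₚ.lookup∘tabulate X i)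

χ-lookup-∁-tabulate : ∀ {n} (X : Fin n → Bool) i → χ (Vec.lookup (∁ (Vec.tabulate X))) i ≡ bit (not (X i))
χ-lookup-∁-tabulate X i =
  cong bit (trans (Vecₚ.lookup-map i not (Vec.tabulate X)) (cong not (Vecₚ.lookup∘tabulate X i)))

∣tabulate∣≡size : ∀ {n} (X : Fin n → Bool) → ∣ Vec.tabulate X ∣ ≡ size X
∣tabulate∣≡size X = trans (∣A∣≡size (Vec.tabulate X)) (sum-cong-≗ (χ-lookup-tabulate X))

module Counting {n : ℕ} (G : Graph n) where

  adjacency : Fin n → Fin n → ℕ
  adjacency i j = bit (adj G i j)

  deg : (Fin n → ℕ) → Fin n → ℕ
  deg y i = sum (λ j → y j * adjacency i j)

  edges : (Fin n → ℕ) → (Fin n → ℕ) → ℕ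
  edges x y = sum (λ i → x i * deg y i)

  NoEdges AllEdges : (Fin n → Bool) → (Fin n → Bool) → Set
  NoEdges X Y = ∀ i j → X i ≡ true → Y j ≡ true → adj G i j ≡ false
  AllEdges X Y = ∀ i j → X i ≡ true → Y j ≡ true → adj G i j ≡ true

  adjacency-sym : ∀ i j → adjacency i j ≡ adjacency j i
  adjacency-sym i j = cong bit (Graph.sym G i j)

  deg-cong : ∀ {y z} → (∀ j → y j ≡ z j) → ∀ i → deg y i ≡ deg z i
  deg-cong y≗z i = sum-cong-≗ (λ j → cong (_* adjacency i j) (y≗z j))

  edges-cong : ∀ {x x′ y y′} → (∀ i → x i ≡ x′ i) → (∀ j → y j ≡ y′ j) → edges x y ≡ edges x′ y′
  edges-cong x≗x′ y≗y′ = sum-cong-≗ (λ i → cong₂ _*_ (x≗x′ i) (deg-cong y≗y′ i))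

  deg-distrib-+ : ∀ y z i → deg (λ j → y j + z j) i ≡ deg y i + deg z i
  deg-distrib-+ y z i =
    trans (sum-cong-≗ (λ j → *-distribʳ-+ (adjacency i j) (y j) (z j))) (∑-distrib-+ {n} _ _)

  edges-distribˡ-+ : ∀ x x′ y → edges (λ i → x i + x′ i) y ≡ edges x y + edges x′ y
  edges-distribˡ-+ x x′ y =
    trans (sum-cong-≗ (λ i → *-distribʳ-+ (deg y i) (x i) (x′ i))) (∑-distrib-+ {n} _ _)

  edges-distribʳ-+ : ∀ x y y′ → edges x (λ j → y j + y′ j) ≡ edges x y + edges x y′
  edges-distribʳ-+ x y y′ = trans
    (sum-cong-≗ (λ i → trans (cong (x i *_) (deg-distrib-+ y y′ i)) (*-distribˡ-+ (x i) _ _)))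
    (∑-distrib-+ {n} _ _)

  edges-comm : ∀ x y → edges x y ≡ edges y x
  edges-comm x y = begin
    sum (λ i → x i * sum (λ j → y j * adjacency i j))
      ≡⟨ sum-cong-≗ (λ i → *-distribˡ-sum {n} (x i) _) ⟩
    sum (λ i → sum (λ j → x i * (y j * adjacency i j)))
      ≡⟨ ∑-comm {n} {n} _ ⟩
    sum (λ j → sum (λ i → x i * (y j * adjacency i j)))
      ≡⟨ sum-cong-≗ (λ j → sum-cong-≗ (λ i → swap j i)) ⟩
    sum (λ j → sum (λ i → y j * (x i * adjacency j i)))
      ≡⟨ sum-cong-≗ (λ j → *-distribˡ-sum {n} (y j) _) ⟨
    sum (λ j → y j * sum (λ i → x i * adjacency j i))
      ∎
    where
    open ≡-Reasoning
    swap : ∀ j i → x i * (y j * adjacency i j) ≡ y j * (x i * adjacency j i)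
    swap j i rewrite adjacency-sym i j = x∙yz≈y∙xz (x i) (y j) (adjacency j i)

  edges-+-square : ∀ x y → edges (λ i → x i + y i) (λ i → x i + y i) ≡
    edges x x + 2 * edges x y + edges y y
  edges-+-square x y = begin
    edges x+y x+y
      ≡⟨ edges-distribˡ-+ x y x+y ⟩
    edges x x+y + edges y x+y
      ≡⟨ cong₂ _+_ (edges-distribʳ-+ x x y) (edges-distribʳ-+ y x y) ⟩
    (edges x x + edges x y) + (edges y x + edges y y)
      ≡⟨ cong (λ t → (edges x x + edges x y) + (t + edges y y)) (edges-comm y x) ⟩
    (edges x x + edges x y) + (edges x y + edges y y)
      ≡⟨ rearrange (edges x x) (edges x y) (edges y y) ⟩
    edges x x + 2 * edges x y + edges y y
      ∎
    where
    open ≡-Reasoning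
    x+y = λ i → x i + y i
    rearrange : ∀ p q r → (p + q) + (q + r) ≡ p + 2 * q + r
    rearrange = solve-∀

  deg≤size : ∀ Y i → deg (χ Y) i ≤ size Y
  deg≤size Y i = ≤-trans (sumOver-mono-≤ Y (λ j → bit≤1 (adj G i j))) (≤-reflexive (*-identityʳ (size Y)))

  deg≡0⇒ : ∀ Y i → deg (χ Y) i ≡ 0 → ∀ j → Y j ≡ true → adj G i j ≡ false
  deg≡0⇒ Y i deg≡0 j Yj = bit≡0⇒≡false (sumOver≡0⇒ Y deg≡0 j Yj)

  deg≡0⇐ : ∀ Y i → (∀ j → Y j ≡ true → adj G i j ≡ false) → deg (χ Y) i ≡ 0
  deg≡0⇐ Y i nonadjacent = sumOver≡0⇐ Y (λ j Yj → cong bit (nonadjacent j Yj))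

  deg≡size⇒ : ∀ Y i → deg (χ Y) i ≡ size Y → ∀ j → Y j ≡ true → adj G i j ≡ true
  deg≡size⇒ Y i deg≡size j Yj = bit≡1⇒≡true
    (sumOver-rigid Y (λ j → bit≤1 (adj G i j))
      (≤-reflexive (trans (*-identityʳ (size Y)) (sym deg≡size))) j Yj)

  edges≡0⇒NoEdges : ∀ X Y → edges (χ X) (χ Y) ≡ 0 → NoEdges X Y
  edges≡0⇒NoEdges X Y edges≡0 i j Xi = deg≡0⇒ Y i (sumOver≡0⇒ X edges≡0 i Xi) j

  NoEdges⇒edges≡0 : ∀ X Y → NoEdges X Y → edges (χ X) (χ Y) ≡ 0
  NoEdges⇒edges≡0 X Y noEdges = sumOver≡0⇐ X (λ i Xi → deg≡0⇐ Y i (λ j → noEdges i j Xi))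

  edges≡size*size⇒AllEdges : ∀ X Y → edges (χ X) (χ Y) ≡ size X * size Y → AllEdges X Y
  edges≡size*size⇒AllEdges X Y full i j Xi = deg≡size⇒ Y i
    (sumOver-rigid X (deg≤size Y) (≤-reflexive (sym full)) i Xi) j

  2*e≡edges : ∀ (A : Subset n) → 2 * e G A ≡ edges (χ (Vec.lookup A)) (χ (Vec.lookup A))
  2*e≡edges A = begin
    2 * e G A                                                 ≡⟨ cong (2 *_) e-as-sum ⟩
    2 * sum (λ i → sum (λ j → bit (toℕ i <ᵇ toℕ j) * P i j))  ≡⟨ sum-upperTriangle P P-sym P-diag ⟩
    sum (λ i → sum (λ j → P i j))                             ≡⟨ sum-cong-≗ (λ i → *-distribˡ-sum {n} (x i) _) ⟨
    edges x x                                                 ∎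
    where
    open ≡-Reasoning
    x = χ (Vec.lookup A)
    P : Fin n → Fin n → ℕ
    P i j = x i * (x j * adjacency i j)
    P-sym : ∀ i j → P i j ≡ P j i
    P-sym i j rewrite adjacency-sym i j = x∙yz≈y∙xz (x i) (x j) (adjacency j i)
    P-diag : ∀ i → P i i ≡ 0
    P-diag i rewrite Graph.irrefl G i = trans (cong (x i *_) (*-zeroʳ (x i))) (*-zeroʳ (x i))
    bit-∧⁴ : ∀ p q r s → bit (p ∧ (q ∧ (r ∧ s))) ≡ bit p * (bit q * (bit r * bit s))
    bit-∧⁴ p q r s rewrite bit-∧ p (q ∧ (r ∧ s)) | bit-∧ q (r ∧ s) | bit-∧ r s = refl
    entry : Fin n → Fin n → Bool
    entry i j = (toℕ i <ᵇ toℕ j) ∧ (Vec.lookup A i ∧ (Vec.lookup A j ∧ adj G i j))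
    row : Fin n → ℕ
    row i = List.length (List.filterᵇ (entry i) (List.allFin n))
    e-as-sum : e G A ≡ sum (λ i → sum (λ j → bit (toℕ i <ᵇ toℕ j) * P i j))
    e-as-sum = trans (listSum-allFin row) (sum-cong-≗ λ i →
      trans (length-filterᵇ (entry i) (List.allFin n))
        (trans (listSum-allFin (bit ∘ entry i)) (sum-cong-≗ λ j →
          bit-∧⁴ (toℕ i <ᵇ toℕ j) (Vec.lookup A i) (Vec.lookup A j) (adj G i j))))

  xor-adjacency : ∀ U → NoEdges U U → NoEdges (not ∘ U) (not ∘ U) → AllEdges U (not ∘ U) →
    ∀ i j → adj G i j ≡ U i xor U j
  xor-adjacency U inside outside across i j with U i in Ui | U j in Uj
  ... | true | true = inside i j Ui Uj
  ... | true | false = across i j Ui (cong not Uj)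
  ... | false | true = trans (Graph.sym G i j) (across j i Uj (cong not Ui))
  ... | false | false = outside i j (cong not Ui) (cong not Uj)

-- Mantel's bound

no-triangle : ∀ {n} {G : Graph n} → TriangleFree G → ∀ {i j k} →
  adj G i j ≡ true → adj G j k ≡ true → adj G i k ≡ true → ⊥
no-triangle triangleFree {i} {j} {k} ij jk ik =
  triangleFree i j k (Equivalence.from T-≡ ij , Equivalence.from T-≡ jk , Equivalence.from T-≡ ik)

neighbourhood-independent : ∀ {n} (G : Graph n) → TriangleFree G → ∀ v →
  Counting.NoEdges G (adj G v) (adj G v)
neighbourhood-independent G triangleFree v i j vi vj with adj G i j in ij
... | false = refl
... | true = ⊥-elim (no-triangle {G = G} triangleFree vi ij vj)

module Mantel {n : ℕ} (G : Graph n) (triangleFree : TriangleFree G) where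
  open Counting G

  record Split (R : Fin n → Bool) : Set where
    field
      M N : Fin n → Bool
      M+N≡R : ∀ i → χ M i + χ N i ≡ χ R i
      N-independent : NoEdges N N
      bound : edges (χ R) (χ R) ≤ 2 * (size M * size N)
      tight : edges (χ R) (χ R) ≡ 2 * (size M * size N) → NoEdges M M × AllEdges M N

  -- N = R ∩ Γ(v) is independent because G is triangle-free, and every vertex of M has at most
  -- deg_R(v) = |N| neighbours in R, so e(M) + e(M, N) ≤ |M| |N|.
  neighbourhoodSplit : ∀ R v → (∀ u → deg (χ R) u ≤ deg (χ R) v) → Split R
  neighbourhoodSplit R v v-max = record
    { M = M ; N = N ; M+N≡R = M+N≡R ; N-independent = N-independent ; bound = bound ; tight = tight }
    where
    M N : Fin n → Bool
    M j = R j ∧ not (adj G v j)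
    N j = R j ∧ adj G v j
    M+N≡R : ∀ i → χ M i + χ N i ≡ χ R i
    M+N≡R i = bit-∧-not+bit-∧ (R i) (adj G v i)
    N-independent : NoEdges N N
    N-independent i j Ni Nj = neighbourhood-independent G triangleFree v i j
      (∧-conicalʳ (R i) _ Ni) (∧-conicalʳ (R j) _ Nj)
    x y P : ℕ
    x = edges (χ M) (χ M)
    y = edges (χ M) (χ N)
    P = size M * size N
    edges-R : edges (χ R) (χ R) ≡ x + 2 * y
    edges-R = begin
      edges (χ R) (χ R)                          ≡⟨ edges-cong (sym ∘ M+N≡R) (sym ∘ M+N≡R) ⟩
      edges (λ i → χ M i + χ N i) (λ i → χ M i + χ N i)  ≡⟨ edges-+-square (χ M) (χ N) ⟩
      x + 2 * y + edges (χ N) (χ N)              ≡⟨ cong (x + 2 * y +_) (NoEdges⇒edges≡0 N N N-independent) ⟩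
      x + 2 * y + 0                              ≡⟨ +-identityʳ (x + 2 * y) ⟩
      x + 2 * y                                  ∎
      where open ≡-Reasoning
    x+y≤P : x + y ≤ P
    x+y≤P = begin
      x + y                       ≡⟨ edges-distribʳ-+ (χ M) (χ M) (χ N) ⟨
      edges (χ M) (λ i → χ M i + χ N i)  ≡⟨ edges-cong {χ M} (λ _ → refl) M+N≡R ⟩
      edges (χ M) (χ R)           ≤⟨ sumOver-mono-≤ M v-max ⟩
      size M * deg (χ R) v        ≡⟨ cong (size M *_) (sum-cong-≗ (λ j → sym (bit-∧ (R j) (adj G v j)))) ⟩
      P                           ∎
      where open ≤-Reasoning
    bound : edges (χ R) (χ R) ≤ 2 * P
    bound = begin
      edges (χ R) (χ R)  ≡⟨ edges-R ⟩
      x + 2 * y          ≤⟨ +-monoˡ-≤ (2 * y) (m≤n*m x 2) ⟩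
      2 * x + 2 * y      ≡⟨ *-distribˡ-+ 2 x y ⟨
      2 * (x + y)        ≤⟨ *-monoʳ-≤ 2 x+y≤P ⟩
      2 * P              ∎
      where open ≤-Reasoning
    tight : edges (χ R) (χ R) ≡ 2 * P → NoEdges M M × AllEdges M N
    tight edges-R≡2P =
      let x≡0 , y≡P = x+y≤p∧2p≤x+2y⇒ x y P x+y≤P (≤-reflexive (trans (sym edges-R≡2P) edges-R))
      in edges≡0⇒NoEdges M M x≡0 , edges≡size*size⇒AllEdges M N y≡P

mantel : ∀ {n} (G : Graph n) (triangleFree : TriangleFree G) R → Mantel.Split G triangleFree R
mantel {zero} G triangleFree R = record
  { M = R ; N = R ; M+N≡R = λ () ; N-independent = λ () ; bound = z≤n ; tight = λ _ → (λ ()) , (λ ()) }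
mantel {suc n} G triangleFree R =
  let v , v-max = argmax-Fin zero (Counting.deg G (χ R))
  in Mantel.neighbourhoodSplit G triangleFree R v v-max

-- Cuts through a partition into independent sets

module Cuts {n : ℕ} (G : Graph n) where
  open Counting G

  NoEdges-⊆ : ∀ {X X′ Y Y′} → X′ ⊆ X → Y′ ⊆ Y → NoEdges X Y → NoEdges X′ Y′
  NoEdges-⊆ X′⊆X Y′⊆Y noEdges i j X′i Y′j = noEdges i j (X′⊆X i X′i) (Y′⊆Y j Y′j)

  e≡edges-between : ∀ (A : Subset n) U W → (∀ i → χ (Vec.lookup A) i ≡ χ U i + χ W i) →
    NoEdges U U → NoEdges W W → e G A ≡ edges (χ U) (χ W)
  e≡edges-between A U W A≡U+W U-independent W-independent = *-cancelˡ-≡ (e G A) _ 2 (begin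
    2 * e G A                                           ≡⟨ 2*e≡edges A ⟩
    edges (χ (Vec.lookup A)) (χ (Vec.lookup A))         ≡⟨ edges-cong A≡U+W A≡U+W ⟩
    edges (λ i → χ U i + χ W i) (λ i → χ U i + χ W i)   ≡⟨ edges-+-square (χ U) (χ W) ⟩
    edges (χ U) (χ U) + 2 * edges (χ U) (χ W) + edges (χ W) (χ W)
      ≡⟨ cong₂ (λ u w → u + 2 * edges (χ U) (χ W) + w)
           (NoEdges⇒edges≡0 U U U-independent) (NoEdges⇒edges≡0 W W W-independent) ⟩
    2 * edges (χ U) (χ W) + 0                           ≡⟨ +-identityʳ _ ⟩
    2 * edges (χ U) (χ W)                               ∎)
    where open ≡-Reasoning

  cost-∪ : ∀ S X Y p → (∀ i → χ S i + (χ X i + χ Y i) ≡ 1) →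
    NoEdges S S → NoEdges X X → NoEdges Y Y → p ⊆ S →
    ∣ Vec.tabulate (λ i → X i ∨ p i) ∣ ≡ size X + size p ×
    cost G (Vec.tabulate (λ i → X i ∨ p i)) ≡ edges (χ p) (χ X) + edges (χ (S ─ p)) (χ Y)
  cost-∪ S X Y p partition S-indep X-indep Y-indep p⊆S = ∣A∣ , costA
    where
    A = Vec.tabulate (λ i → X i ∨ p i)
    q = S ─ p
    q⊆S : q ⊆ S
    q⊆S i = ∧-conicalˡ (S i) (not (p i))
    split : ∀ i → bit (X i ∨ p i) ≡ χ X i + χ p i × bit (not (X i ∨ p i)) ≡ χ Y i + χ q i
    split i = bit-∨-split (S i) (X i) (Y i) (p i) (partition i) (p⊆S i)
    ∣A∣ : ∣ A ∣ ≡ size X + size p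
    ∣A∣ = trans (∣A∣≡size A) (trans (sum-cong-≗ (λ i → trans (χ-lookup-tabulate _ i) (proj₁ (split i))))
            (∑-distrib-+ {n} (χ X) (χ p)))
    costA : cost G A ≡ edges (χ p) (χ X) + edges (χ q) (χ Y)
    costA = cong₂ _+_
      (trans (e≡edges-between A X p (λ i → trans (χ-lookup-tabulate _ i) (proj₁ (split i))) X-indep
               (NoEdges-⊆ p⊆S p⊆S S-indep)) (edges-comm (χ X) (χ p)))
      (trans (e≡edges-between (∁ A) Y q (λ i → trans (χ-lookup-∁-tabulate _ i) (proj₂ (split i))) Y-indep
               (NoEdges-⊆ q⊆S q⊆S S-indep)) (edges-comm (χ Y) (χ q)))

-- The extremal configuration

record TightConfiguration {n} (G : Graph n) (k : ℕ) : Set where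
  open Counting G
  field
    S U V : Fin n → Bool
    partition : ∀ i → χ S i + (χ U i + χ V i) ≡ 1
    S-independent : NoEdges S S
    U-independent : NoEdges U U
    V-independent : NoEdges V V
    U-V-complete : AllEdges U V
    ∣S∣≡k+k : size S ≡ k + k
    ∣U∣≡k : size U ≡ k
    ∣V∣≡k : size V ≡ k
    balanced : ∀ A → ∣ A ∣ ≡ k + k → k * k ≤ cost G A

swap : ∀ {n} {G : Graph n} {k} → TightConfiguration G k → TightConfiguration G k
swap {G = G} c = record
  { S = S ; U = V ; V = U
  ; partition = λ i → trans (cong (χ S i +_) (+-comm (χ V i) (χ U i))) (partition i)
  ; S-independent = S-independent ; U-independent = V-independent ; V-independent = U-independent
  ; U-V-complete = λ i j Vi Uj → trans (Graph.sym G i j) (U-V-complete j i Uj Vi)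
  ; ∣S∣≡k+k = ∣S∣≡k+k ; ∣U∣≡k = ∣V∣≡k ; ∣V∣≡k = ∣U∣≡k ; balanced = balanced
  }
  where open TightConfiguration c

module Extremal {n} {G : Graph n} (triangleFree : TriangleFree G) {k} (c : TightConfiguration G k) where
  open TightConfiguration c
  open Counting G
  open Cuts G

  deg-U≢0⇒deg-V≡0 : ∀ i → deg (χ U) i ≢ 0 → deg (χ V) i ≡ 0
  deg-U≢0⇒deg-V≡0 i deg-U≢0 = deg≡0⇐ V i no-V-neighbour
    where
    no-V-neighbour : ∀ l → V l ≡ true → adj G i l ≡ false
    no-V-neighbour l Vl with adj G i l in il
    ... | false = refl
    ... | true = ⊥-elim (deg-U≢0 (deg≡0⇐ U i no-U-neighbour))
      where
      no-U-neighbour : ∀ j → U j ≡ true → adj G i j ≡ false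
      no-U-neighbour j Uj with adj G i j in ij
      ... | false = refl
      ... | true = ⊥-elim (no-triangle {G = G} triangleFree ij (U-V-complete j l Uj Vl) il)

  deg-U+deg-V≤k : ∀ i → deg (χ U) i + deg (χ V) i ≤ k
  deg-U+deg-V≤k i with deg (χ U) i ≟ 0
  ... | yes deg-U≡0 = ≤-trans (≤-reflexive (cong (_+ deg (χ V) i) deg-U≡0))
                        (subst (deg (χ V) i ≤_) ∣V∣≡k (deg≤size V i))
  ... | no deg-U≢0 = ≤-trans
    (≤-reflexive (trans (cong (deg (χ U) i +_) (deg-U≢0⇒deg-V≡0 i deg-U≢0)) (+-identityʳ _)))
    (subst (deg (χ U) i ≤_) ∣U∣≡k (deg≤size U i))

  balanced-cuts : ∀ p → p ⊆ S → size p ≡ k →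
    edges (χ p) (χ U) + edges (χ (S ─ p)) (χ V) ≡ k * k ×
    (∀ i → S i ≡ true → deg (χ U) i + deg (χ V) i ≡ k)
  balanced-cuts p p⊆S ∣p∣≡k = proj₁ cuts≡k² , full
    where
    q = S ─ p
    degUV : Fin n → ℕ
    degUV i = deg (χ U) i + deg (χ V) i
    cut₁ = cost-∪ S U V p partition S-independent U-independent V-independent p⊆S
    cut₂ = cost-∪ S V U p (TightConfiguration.partition (swap c)) S-independent V-independent U-independent p⊆S
    k²≤cut : ∀ X {c} → size X ≡ k → let A = Vec.tabulate (λ i → X i ∨ p i) in
      ∣ A ∣ ≡ size X + size p → cost G A ≡ c → k * k ≤ c
    k²≤cut X ∣X∣≡k ∣A∣ cost≡c =
      subst (k * k ≤_) cost≡c (balanced (Vec.tabulate (λ i → X i ∨ p i)) (trans ∣A∣ (cong₂ _+_ ∣X∣≡k ∣p∣≡k)))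
    cuts≡sum : (edges (χ p) (χ U) + edges (χ q) (χ V)) + (edges (χ p) (χ V) + edges (χ q) (χ U)) ≡
               sumOver S degUV
    cuts≡sum = begin
      (edges (χ p) (χ U) + edges (χ q) (χ V)) + (edges (χ p) (χ V) + edges (χ q) (χ U))
        ≡⟨ interchange (edges (χ p) (χ U)) (edges (χ q) (χ V)) (edges (χ p) (χ V)) (edges (χ q) (χ U)) ⟩
      (edges (χ p) (χ U) + edges (χ p) (χ V)) + (edges (χ q) (χ U) + edges (χ q) (χ V))
        ≡⟨ cong₂ _+_ (sumOver-distrib-+ p _ _) (sumOver-distrib-+ q _ _) ⟨
      sumOver p degUV + sumOver q degUV
        ≡⟨ sumOver-split S p q degUV (λ i → bit-⊆-split (S i) (p i) (p⊆S i)) ⟨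
      sumOver S degUV ∎
      where
      open ≡-Reasoning
      interchange : ∀ a b c d → (a + b) + (c + d) ≡ (a + c) + (d + b)
      interchange = solve-∀
    sum≤2k² : sumOver S degUV ≤ k * k + k * k
    sum≤2k² = ≤-trans (sumOver-mono-≤ S deg-U+deg-V≤k)
      (≤-reflexive (trans (cong (_* k) ∣S∣≡k+k) (*-distribʳ-+ k k k)))
    cuts≡k² = ≤∧≤∧+≤⇒≡
      (k²≤cut U ∣U∣≡k (proj₁ cut₁) (proj₂ cut₁)) (k²≤cut V ∣V∣≡k (proj₁ cut₂) (proj₂ cut₂))
      (≤-trans (≤-reflexive cuts≡sum) sum≤2k²)
    full : ∀ i → S i ≡ true → degUV i ≡ k
    full = sumOver-rigid S deg-U+deg-V≤k (begin
      size S * k                ≡⟨ cong (_* k) ∣S∣≡k+k ⟩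
      (k + k) * k               ≡⟨ *-distribʳ-+ k k k ⟩
      k * k + k * k             ≡⟨ cong₂ _+_ (proj₁ cuts≡k²) (proj₂ cuts≡k²) ⟨
      (edges (χ p) (χ U) + edges (χ q) (χ V)) + (edges (χ p) (χ V) + edges (χ q) (χ U))
                                ≡⟨ cuts≡sum ⟩
      sumOver S degUV           ∎)
      where open ≤-Reasoning

  -- When p avoids V, the cut (U ∪ p, V ∪ S ∖ p) already costs k² between p and U, which leaves no
  -- edge between S ∖ p and V.
  saturate : ∀ p → p ⊆ S → size p ≡ k → (∀ i → p i ≡ true → deg (χ V) i ≡ 0) →
    ∀ i → S i ≡ true → deg (χ V) i ≡ 0 × deg (χ U) i ≡ k
  saturate p p⊆S ∣p∣≡k p-avoids-V i Si = avoids-V i Si , deg-U≡k i Si (avoids-V i Si)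
    where
    cut≡k² = proj₁ (balanced-cuts p p⊆S ∣p∣≡k)
    full = proj₂ (balanced-cuts p p⊆S ∣p∣≡k)
    deg-U≡k : ∀ i → S i ≡ true → deg (χ V) i ≡ 0 → deg (χ U) i ≡ k
    deg-U≡k i Si deg-V≡0 = trans (sym (trans (cong (deg (χ U) i +_) deg-V≡0) (+-identityʳ _))) (full i Si)
    edges-p-U≡k² : edges (χ p) (χ U) ≡ k * k
    edges-p-U≡k² = trans (sumOver-cong p (λ i pi → deg-U≡k i (p⊆S i pi) (p-avoids-V i pi)))
                     (trans (sumOver-const p k) (cong (_* k) ∣p∣≡k))
    edges-rest-V≡0 : edges (χ (S ─ p)) (χ V) ≡ 0
    edges-rest-V≡0 = +-cancelˡ-≡ (k * k) _ _
      (trans (cong (_+ edges (χ (S ─ p)) (χ V)) (sym edges-p-U≡k²)) (trans cut≡k² (sym (+-identityʳ _))))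
    avoids-V : ∀ i → S i ≡ true → deg (χ V) i ≡ 0
    avoids-V i Si with p i in pi
    ... | true = p-avoids-V i pi
    ... | false = sumOver≡0⇒ (S ─ p) edges-rest-V≡0 i (cong₂ (λ s t → s ∧ not t) Si pi)

  xor-adjacency-from : ∀ p → p ⊆ S → size p ≡ k → (∀ i → p i ≡ true → deg (χ V) i ≡ 0) →
    ∀ i j → adj G i j ≡ U i xor U j
  xor-adjacency-from p p⊆S ∣p∣≡k p-avoids-V = xor-adjacency U U-independent outside across
    where
    saturated = saturate p p⊆S ∣p∣≡k p-avoids-V
    S-or-V : ∀ i → not (U i) ≡ true → S i ≡ true ⊎ V i ≡ true
    S-or-V i = bit-one-of-three (S i) (U i) (V i) (partition i)
    outside : NoEdges (not ∘ U) (not ∘ U)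
    outside i j ¬Ui ¬Uj with S-or-V i ¬Ui | S-or-V j ¬Uj
    ... | inj₁ Si | inj₁ Sj = S-independent i j Si Sj
    ... | inj₁ Si | inj₂ Vj = deg≡0⇒ V i (proj₁ (saturated i Si)) j Vj
    ... | inj₂ Vi | inj₁ Sj = trans (Graph.sym G i j) (deg≡0⇒ V j (proj₁ (saturated j Sj)) i Vi)
    ... | inj₂ Vi | inj₂ Vj = V-independent i j Vi Vj
    across : AllEdges U (not ∘ U)
    across i j Ui ¬Uj with S-or-V j ¬Uj
    ... | inj₁ Sj =
      trans (Graph.sym G i j) (deg≡size⇒ U j (trans (proj₂ (saturated j Sj)) (sym ∣U∣≡k)) i Ui)
    ... | inj₂ Vj = U-V-complete i j Ui Vj

  V-avoiders : Fin n → Bool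
  V-avoiders i = S i ∧ (deg (χ V) i ≡ᵇ 0)

  xor-adjacency-from-V-avoiders : k ≤ size V-avoiders → ∀ i j → adj G i j ≡ (U i xor U j)
  xor-adjacency-from-V-avoiders k≤∣V-avoiders∣ = xor-adjacency-from p p⊆S ∣p∣≡k p-avoids-V
    where
    p-data = subset-of-size V-avoiders k k≤∣V-avoiders∣
    p = proj₁ p-data
    ∣p∣≡k = proj₂ (proj₂ p-data)
    p⊆S : p ⊆ S
    p⊆S i pi = ∧-conicalˡ (S i) _ (proj₁ (proj₂ p-data) i pi)
    p-avoids-V : ∀ i → p i ≡ true → deg (χ V) i ≡ 0
    p-avoids-V i pi = ≡ᵇ0⇒≡0 (∧-conicalʳ (S i) _ (proj₁ (proj₂ p-data) i pi))

  ∣S∣≤∣V-avoiders∣+∣U-avoiders∣ : size S ≤ size V-avoiders + size (λ i → S i ∧ (deg (χ U) i ≡ᵇ 0))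
  ∣S∣≤∣V-avoiders∣+∣U-avoiders∣ = ≤-trans
    (sum-mono-≤ (λ i → bit-∧-cover (S i) _ _ (λ _ → avoids-V-or-U i)))
    (≤-reflexive (∑-distrib-+ {n} (χ V-avoiders) _))
    where
    avoids-V-or-U : ∀ i → (deg (χ V) i ≡ᵇ 0) ≡ true ⊎ (deg (χ U) i ≡ᵇ 0) ≡ true
    avoids-V-or-U i with deg (χ U) i ≟ 0
    ... | yes deg-U≡0 = inj₂ (cong (_≡ᵇ 0) deg-U≡0)
    ... | no deg-U≢0 = inj₁ (cong (_≡ᵇ 0) (deg-U≢0⇒deg-V≡0 i deg-U≢0))

extremal-structure : ∀ {n} {G : Graph n} → TriangleFree G → ∀ {k} → TightConfiguration G k →
  ∃ λ X → size X ≡ k × (∀ i j → adj G i j ≡ (X i xor X j))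
extremal-structure {G = G} triangleFree {k} c = by-cases
  (k+k≤a+b⇒k≤a⊎k≤b (size V-avoiders) (size U-avoiders) k
    (subst (_≤ size V-avoiders + size U-avoiders) ∣S∣≡k+k ∣S∣≤∣V-avoiders∣+∣U-avoiders∣))
  where
  open TightConfiguration c using (U; V; ∣U∣≡k; ∣V∣≡k; ∣S∣≡k+k)
  open Extremal triangleFree c using (V-avoiders; ∣S∣≤∣V-avoiders∣+∣U-avoiders∣)
  module Swapped = Extremal triangleFree (swap c)
  U-avoiders = Swapped.V-avoiders
  by-cases : k ≤ size V-avoiders ⊎ k ≤ size U-avoiders →
    ∃ λ X → size X ≡ k × (∀ i j → adj G i j ≡ (X i xor X j))
  by-cases (inj₁ k≤∣V-avoiders∣) = U , ∣U∣≡k , Extremal.xor-adjacency-from-V-avoiders triangleFree c k≤∣V-avoiders∣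
  by-cases (inj₂ k≤∣U-avoiders∣) = V , ∣V∣≡k , Swapped.xor-adjacency-from-V-avoiders k≤∣U-avoiders∣

-- Complete bipartite graphs

module Bipartition where
  open import Data.Vec using (Vec; []; _∷_)

  toClasses : ∀ {n} (T : Subset n) → Fin n → Fin ∣ ∁ T ∣ ⊎ Fin ∣ T ∣
  toClasses (true ∷ T) zero = inj₂ zero
  toClasses (false ∷ T) zero = inj₁ zero
  toClasses (true ∷ T) (suc i) = Sum.map₂ suc (toClasses T i)
  toClasses (false ∷ T) (suc i) = Sum.map₁ suc (toClasses T i)

  fromClasses : ∀ {n} (T : Subset n) → Fin ∣ ∁ T ∣ ⊎ Fin ∣ T ∣ → Fin n
  fromClasses (true ∷ T) (inj₂ zero) = zero
  fromClasses (true ∷ T) (inj₂ (suc y)) = suc (fromClasses T (inj₂ y))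
  fromClasses (true ∷ T) (inj₁ x) = suc (fromClasses T (inj₁ x))
  fromClasses (false ∷ T) (inj₁ zero) = zero
  fromClasses (false ∷ T) (inj₁ (suc x)) = suc (fromClasses T (inj₁ x))
  fromClasses (false ∷ T) (inj₂ y) = suc (fromClasses T (inj₂ y))

  fromClasses∘toClasses : ∀ {n} (T : Subset n) i → fromClasses T (toClasses T i) ≡ i
  fromClasses∘toClasses (true ∷ T) zero = refl
  fromClasses∘toClasses (false ∷ T) zero = refl
  fromClasses∘toClasses (true ∷ T) (suc i) with toClasses T i | fromClasses∘toClasses T i
  ... | inj₁ _ | eq = cong suc eq
  ... | inj₂ _ | eq = cong suc eq
  fromClasses∘toClasses (false ∷ T) (suc i) with toClasses T i | fromClasses∘toClasses T i
  ... | inj₁ _ | eq = cong suc eq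
  ... | inj₂ _ | eq = cong suc eq

  toClasses∘fromClasses : ∀ {n} (T : Subset n) z → toClasses T (fromClasses T z) ≡ z
  toClasses∘fromClasses (true ∷ T) (inj₂ zero) = refl
  toClasses∘fromClasses (true ∷ T) (inj₂ (suc y)) rewrite toClasses∘fromClasses T (inj₂ y) = refl
  toClasses∘fromClasses (true ∷ T) (inj₁ x) rewrite toClasses∘fromClasses T (inj₁ x) = refl
  toClasses∘fromClasses (false ∷ T) (inj₁ zero) = refl
  toClasses∘fromClasses (false ∷ T) (inj₁ (suc x)) rewrite toClasses∘fromClasses T (inj₁ x) = refl
  toClasses∘fromClasses (false ∷ T) (inj₂ y) rewrite toClasses∘fromClasses T (inj₂ y) = refl

  isInj₁ : ∀ {A B : Set} → A ⊎ B → Bool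
  isInj₁ (inj₁ _) = true
  isInj₁ (inj₂ _) = false

  isInj₁-toClasses : ∀ {n} (T : Subset n) i → isInj₁ (toClasses T i) ≡ not (Vec.lookup T i)
  isInj₁-toClasses (true ∷ T) zero = refl
  isInj₁-toClasses (false ∷ T) zero = refl
  isInj₁-toClasses (true ∷ T) (suc i) with toClasses T i | isInj₁-toClasses T i
  ... | inj₁ _ | eq = eq
  ... | inj₂ _ | eq = eq
  isInj₁-toClasses (false ∷ T) (suc i) with toClasses T i | isInj₁-toClasses T i
  ... | inj₁ _ | eq = eq
  ... | inj₂ _ | eq = eq

  m+n<ᵇm≡false : ∀ m n → (m + n <ᵇ m) ≡ false
  m+n<ᵇm≡false zero n = refl
  m+n<ᵇm≡false (suc m) n = m+n<ᵇm≡false m n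

  join-<ᵇ : ∀ c t (z : Fin c ⊎ Fin t) → (toℕ (join c t z) <ᵇ c) ≡ isInj₁ z
  join-<ᵇ c t (inj₁ x) = Equivalence.to T-≡ (<⇒<ᵇ (subst (_< c) (sym (toℕ-↑ˡ x t)) (toℕ<n x)))
  join-<ᵇ c t (inj₂ y) rewrite toℕ-↑ʳ c y = m+n<ᵇm≡false c (toℕ y)

  not-xor-not : ∀ x y → (not x xor not y) ≡ (x xor y)
  not-xor-not true true = refl
  not-xor-not true false = refl
  not-xor-not false true = refl
  not-xor-not false false = refl

  xor-graph≅K : ∀ {n} (G : Graph n) (T : Subset n) →
    (∀ i j → adj G i j ≡ (Vec.lookup T i xor Vec.lookup T j)) → G ≅ K ∣ ∁ T ∣ ∣ T ∣
  xor-graph≅K G T adj≡xor = σ , preserves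
    where
    c = ∣ ∁ T ∣
    t = ∣ T ∣
    σ : Fin _ ↔ Fin (c + t)
    σ = mk↔ₛ′ (join c t ∘ toClasses T) (fromClasses T ∘ splitAt c)
      (λ z → trans (cong (join c t) (toClasses∘fromClasses T (splitAt c z))) (join-splitAt c t z))
      (λ i → trans (cong (fromClasses T) (splitAt-join c t (toClasses T i))) (fromClasses∘toClasses T i))
    inFirstClass : ∀ i → (toℕ (Inverse.to σ i) <ᵇ c) ≡ not (Vec.lookup T i)
    inFirstClass i = trans (join-<ᵇ c t (toClasses T i)) (isInj₁-toClasses T i)
    preserves : ∀ i j → adj G i j ≡ adj (K c t) (Inverse.to σ i) (Inverse.to σ j)
    preserves i j = trans (adj≡xor i j) (trans (sym (not-xor-not (Vec.lookup T i) (Vec.lookup T j)))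
      (sym (cong₂ _xor_ (inFirstClass i) (inFirstClass j))))

xor-adjacency⇒≅K : ∀ {n} (G : Graph n) (X : Fin n → Bool) {a b} → size (not ∘ X) ≡ a → size X ≡ b →
  (∀ i j → adj G i j ≡ (X i xor X j)) → G ≅ K a b
xor-adjacency⇒≅K G X {a} {b} ∣¬X∣≡a ∣X∣≡b adj≡xor = subst₂ (λ a b → G ≅ K a b) ∣∁A∣≡a ∣A∣≡b
  (Bipartition.xor-graph≅K G A (λ i j → trans (adj≡xor i j)
    (sym (cong₂ _xor_ (Vecₚ.lookup∘tabulate X i) (Vecₚ.lookup∘tabulate X j)))))
  where
  A = Vec.tabulate X
  ∣A∣≡b : ∣ A ∣ ≡ b
  ∣A∣≡b = trans (∣tabulate∣≡size X) ∣X∣≡b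
  ∣∁A∣≡a : ∣ ∁ A ∣ ≡ a
  ∣∁A∣≡a = trans (∣A∣≡size (∁ A)) (trans (sum-cong-≗ (χ-lookup-∁-tabulate X)) ∣¬X∣≡a)

record Decomposition {n} (G : Graph n) (m d : ℕ) : Set where
  open Counting G
  field
    S M N : Fin n → Bool
    partition : ∀ i → χ S i + (χ M i + χ N i) ≡ 1
    S-independent : NoEdges S S
    N-independent : NoEdges N N
    ∣S∣≡m : size S ≡ m
    ∣M∣+∣N∣≡m : size M + size N ≡ m
    d≤∣M∣∣N∣ : d ≤ size M * size N
    tight : d ≡ size M * size N → NoEdges M M × AllEdges M N

Independent⇒NoEdges : ∀ {n} {G : Graph n} {I} → Independent G I →
  Counting.NoEdges G (Vec.lookup I) (Vec.lookup I)
Independent⇒NoEdges {I = I} I-independent i j Ii Ij = ¬-not λ ij →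
  I-independent i j (Vecₚ.lookup⇒[]= i I Ii) (Vecₚ.lookup⇒[]= j I Ij) (Equivalence.from T-≡ ij)

decompose : ∀ {m} {G : Graph (m + m)} → TriangleFree G → IndepAtLeast G m → ∀ {d} →
  (∀ A → ∣ A ∣ ≡ m → d ≤ cost G A) → Decomposition G m d
decompose {m} {G} triangleFree (I , I-independent , m≤∣I∣) {d} d-lower = record
  { S = S ; M = M ; N = N ; partition = partition
  ; S-independent = S-independent ; N-independent = N-independent
  ; ∣S∣≡m = ∣S∣≡m ; ∣M∣+∣N∣≡m = ∣M∣+∣N∣≡m ; d≤∣M∣∣N∣ = d≤∣M∣∣N∣ ; tight = tight′
  }
  where
  open Counting G
  open Cuts G
  S-data = subset-of-size (Vec.lookup I) m (subst (m ≤_) (∣A∣≡size I) m≤∣I∣)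
  S = proj₁ S-data
  ∣S∣≡m = proj₂ (proj₂ S-data)
  S⊆I = proj₁ (proj₂ S-data)
  S-independent : NoEdges S S
  S-independent = NoEdges-⊆ S⊆I S⊆I (Independent⇒NoEdges {G = G} I-independent)
  open Mantel.Split (mantel G triangleFree (not ∘ S))
  partition : ∀ i → χ S i + (χ M i + χ N i) ≡ 1
  partition i = trans (cong (χ S i +_) (M+N≡R i)) (bit+bit-not (S i))
  ∣M∣+∣N∣≡m : size M + size N ≡ m
  ∣M∣+∣N∣≡m = +-cancelˡ-≡ m _ _ (begin
    m + (size M + size N)      ≡⟨ cong₂ _+_ ∣S∣≡m (∑-distrib-+ (χ M) (χ N)) ⟨
    size S + sum (λ i → χ M i + χ N i)  ≡⟨ cong (size S +_) (sum-cong-≗ M+N≡R) ⟩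
    size S + size (not ∘ S)   ≡⟨ size+size-not S ⟩
    m + m                     ∎)
    where open ≡-Reasoning
  A = Vec.tabulate S
  e-A≡0 : e G A ≡ 0
  e-A≡0 = *-cancelˡ-≡ (e G A) 0 2
    (trans (2*e≡edges A) (trans (edges-cong (χ-lookup-tabulate S) (χ-lookup-tabulate S))
      (NoEdges⇒edges≡0 S S S-independent)))
  2d≤edges-R : 2 * d ≤ edges (χ (not ∘ S)) (χ (not ∘ S))
  2d≤edges-R = begin
    2 * d                ≤⟨ *-monoʳ-≤ 2 (d-lower A (trans (∣tabulate∣≡size S) ∣S∣≡m)) ⟩
    2 * cost G A         ≡⟨ cong (λ t → 2 * (t + e G (∁ A))) e-A≡0 ⟩
    2 * e G (∁ A)        ≡⟨ 2*e≡edges (∁ A) ⟩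
    edges (χ (Vec.lookup (∁ A))) (χ (Vec.lookup (∁ A)))
                         ≡⟨ edges-cong (χ-lookup-∁-tabulate S) (χ-lookup-∁-tabulate S) ⟩
    edges (χ (not ∘ S)) (χ (not ∘ S))  ∎
    where open ≤-Reasoning
  d≤∣M∣∣N∣ : d ≤ size M * size N
  d≤∣M∣∣N∣ = *-cancelˡ-≤ 2 (≤-trans 2d≤edges-R bound)
  tight′ : d ≡ size M * size N → NoEdges M M × AllEdges M N
  tight′ d≡∣M∣∣N∣ =
    tight (≤-antisym bound (subst (λ t → 2 * t ≤ edges (χ (not ∘ S)) (χ (not ∘ S))) d≡∣M∣∣N∣ 2d≤edges-R))

tightConfiguration : ∀ {n m d} {G : Graph n} (D : Decomposition G m d) → (∀ A → ∣ A ∣ ≡ m → d ≤ cost G A) →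
  let open Decomposition D in d ≡ size M * size N → size M ≡ size N → TightConfiguration G (size M)
tightConfiguration {m = m} {d} {G} D d-lower d≡∣M∣∣N∣ ∣M∣≡∣N∣ = record
  { S = S ; U = M ; V = N ; partition = partition
  ; S-independent = S-independent ; U-independent = proj₁ (tight d≡∣M∣∣N∣) ; V-independent = N-independent
  ; U-V-complete = proj₂ (tight d≡∣M∣∣N∣)
  ; ∣S∣≡k+k = trans ∣S∣≡m (sym k+k≡m) ; ∣U∣≡k = refl ; ∣V∣≡k = sym ∣M∣≡∣N∣
  ; balanced = λ A ∣A∣≡k+k → subst (_≤ cost G A) d≡k*k (d-lower A (trans ∣A∣≡k+k k+k≡m))
  }
  where
  open Decomposition D
  k+k≡m : size M + size M ≡ m
  k+k≡m = trans (cong (size M +_) ∣M∣≡∣N∣) ∣M∣+∣N∣≡m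
  d≡k*k : d ≡ size M * size M
  d≡k*k = trans d≡∣M∣∣N∣ (cong (size M *_) (sym ∣M∣≡∣N∣))

≅K[3k,k] : ∀ {m} (G : Graph (m + m)) (X : Fin (m + m) → Bool) k → k + k ≡ m → size X ≡ k →
  (∀ i j → adj G i j ≡ (X i xor X j)) → Σ (3 * k + k ≡ m + m) λ _ → G ≅ K (3 * k) k
≅K[3k,k] {m} G X k k+k≡m ∣X∣≡k adj≡xor = 3k+k≡m+m , xor-adjacency⇒≅K G X ∣¬X∣≡3k ∣X∣≡k adj≡xor
  where
  3k+k≡m+m : 3 * k + k ≡ m + m
  3k+k≡m+m = trans (regroup k) (cong (λ t → t + t) k+k≡m)
    where
    regroup : ∀ k → 3 * k + k ≡ (k + k) + (k + k)
    regroup = solve-∀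
  ∣¬X∣≡3k : size (not ∘ X) ≡ 3 * k
  ∣¬X∣≡3k = +-cancelˡ-≡ k _ _ (begin
    k + size (not ∘ X)       ≡⟨ cong (_+ size (not ∘ X)) ∣X∣≡k ⟨
    size X + size (not ∘ X)  ≡⟨ size+size-not X ⟩
    m + m                    ≡⟨ 3k+k≡m+m ⟨
    3 * k + k                ≡⟨ +-comm (3 * k) k ⟩
    k + 3 * k                ∎)
    where open ≡-Reasoning

lemma3p3 : (m : ℕ) (G : Graph (m + m)) → TriangleFree G → IndepAtLeast G m →
    (d : ℕ) → IsD2b {m} G d →
    (16 * d ≤ (m + m) * (m + m)) ×
    (16 * d ≡ (m + m) * (m + m) → ∃[ k ] (Σ (3 * k + k ≡ m + m) λ _ → G ≅ K (3 * k) k))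
lemma3p3 m G triangleFree α≥m d (_ , d-minimal) = bound , equality
  where
  D : Decomposition G m d
  D = decompose triangleFree α≥m d-minimal
  open Decomposition D
  bound : 16 * d ≤ (m + m) * (m + m)
  bound = subst (λ s → 16 * d ≤ (s + s) * (s + s)) ∣M∣+∣N∣≡m (16d≤[2[a+b]]² (size M) (size N) d≤∣M∣∣N∣)
  equality : 16 * d ≡ (m + m) * (m + m) → ∃[ k ] (Σ (3 * k + k ≡ m + m) λ _ → G ≅ K (3 * k) k)
  equality 16d≡[2m]² = size M , ≅K[3k,k] G X (size M) k+k≡m ∣X∣≡k adj≡xor
    where
    amgm = 16d≡[2[a+b]]²⇒ (size M) (size N) d≤∣M∣∣N∣
      (subst (λ s → 16 * d ≡ (s + s) * (s + s)) (sym ∣M∣+∣N∣≡m) 16d≡[2m]²)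
    k+k≡m = trans (cong (size M +_) (proj₂ amgm)) ∣M∣+∣N∣≡m
    structure = extremal-structure triangleFree (tightConfiguration D d-minimal (proj₁ amgm) (proj₂ amgm))
    X = proj₁ structure
    ∣X∣≡k = proj₁ (proj₂ structure)
    adj≡xor = proj₂ (proj₂ structure)
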